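{- Let $|q|<1$ (with $q\neq 0$). For every nonnegative integer $n$, \[ {}_{3}\phi_{2}\left(\begin{matrix}q^{ -2n},\,q^{2n+2},\,q^{2}\\ -q^{2},\,-q^{3} \end{matrix};q^{2},q\right)=\frac{(-1)^{n}(1+q)}{q^{n^{2}}(1+q^{2n+1})}\sum_{j=-n}^{n}(-1)^{j}q^{j^{2}}. \]
   Context: For complex $x$: $(x;p)_0=1$, $(x;p)_k=\prod_{i=0}^{k-1}(1-xp^i)$, $(x_1,\dots,x_m;p)_k=(x_1;p)_k\cdots(x_m;p)_k$. The basic hypergeometric series is ${}_{3}\phi_{2}\left(\begin{matrix}a_{1},a_2,a_{3}\\ b_{1},b_{2}\end{matrix};p,z\right)=\sum_{k=0}^{\infty}\frac{(a_{1},a_2,a_{3};p)_{k}}{(p,b_{1},b_{2};p)_{k}}z^{k}$; when $a_1=p^{ -m}$ for a nonnegative integer $m$ the sum terminates at $k=m$. -}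

module Defs where

open import Level using (Level; suc; _⊔_)
open import Data.Nat as ℕ using (ℕ)
open import Data.Integer as ℤ using (ℤ)
open import Relation.Nullary using (¬_)
open import Algebra.Bundles using (CommutativeRing)

-- A field: a commutative ring with 0 ≠ 1 and a (total) inverse operation
-- which is a two-sided inverse on every nonzero element (value at 0 irrelevant).
record Field c ℓ : Set (suc (c ⊔ ℓ)) where
  field
    commutativeRing : CommutativeRing c ℓ
  open CommutativeRing commutativeRing public
  field
    _⁻¹     : Carrier → Carrier
    ⁻¹-inverse : ∀ x → ¬ (x ≈ 0#) → x * (x ⁻¹) ≈ 1#
    0≉1     : ¬ (0# ≈ 1#)

module FieldDefs {c ℓ} (F : Field c ℓ) where
  open Field F public

  infixr 8 _^_
  _^_ : Carrier → ℕ → Carrier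
  x ^ ℕ.zero    = 1#
  x ^ ℕ.suc n = x * (x ^ n)

  _÷_ : Carrier → Carrier → Carrier
  x ÷ y = x * (y ⁻¹)

  qPoch : Carrier → Carrier → ℕ → Carrier
  qPoch x p ℕ.zero      = 1#
  qPoch x p (ℕ.suc k) = qPoch x p k * (1# - x * (p ^ k))

  sumTo : ℕ → (ℕ → Carrier) → Carrier
  sumTo ℕ.zero      f = f ℕ.zero
  sumTo (ℕ.suc N) f = sumTo N f + f (ℕ.suc N)

  phi32Term : Carrier → Carrier → Carrier → Carrier → Carrier → Carrier → Carrier → ℕ → Carrier
  phi32Term a₁ a₂ a₃ b₁ b₂ p z k =
    (qPoch a₁ p k * qPoch a₂ p k * qPoch a₃ p k * (z ^ k))
      ÷ (qPoch p p k * qPoch b₁ p k * qPoch b₂ p k)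

  -- terminating 3φ2 with a₁ = p^{-m}: the series is the sum of terms k = 0 … m
  -- (all terms with k > m vanish since (p^{-m};p)_k contains the factor 1 - p^{-m} p^m).
  phi32Terminating : ℕ → Carrier → Carrier → Carrier → Carrier → Carrier → Carrier → Carrier
  phi32Terminating m a₂ a₃ b₁ b₂ p z =
    sumTo m (phi32Term ((p ⁻¹) ^ m) a₂ a₃ b₁ b₂ p z)

  sumSym : ℕ → (ℤ → Carrier) → Carrier
  sumSym n f = sumTo (2 ℕ.* n) (λ i → f (ℤ.+ i ℤ.- ℤ.+ n))

  signZ : ℤ → Carrier
  signZ j = (- 1#) ^ ℤ.∣ j ∣

  powSq : Carrier → ℤ → Carrier
  powSq q j = q ^ (ℤ.∣ j ∣ ℕ.* ℤ.∣ j ∣)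

module Submission where

--   S_n := 3φ2(p^{-n}, q^{2n+2}, p ; -p, -q³ ; p, q) = (-1)^n (1+q) / (q^{n²}(1+q^{2n+1})) · D_n,
--   p = q²,  D_n = Σ_{j=-n}^{n} (-1)^j q^{j²},
--
-- by induction on n, following a creative-telescoping (WZ) argument.  Writing
-- t_N(k) for the k-th term of S_N and a = p^N, the rational certificate
--   G(k) = a (1+p^k)(1+q p^k) (p^{-N};p)_k (a;p)_k q^k / ((-p;p)_k (-q³;p)_k)
-- satisfies  a(1+aq) t_N(k) + (q+a) t_{N-1}(k) = G(k) - G(k+1),  so summing over
-- k = 0…N gives the three-term recurrence  a(1+aq) S_N + (q+a) S_{N-1} = 2a(1+q).
-- Together with  D_N = D_{N-1} + 2(-1)^N q^{N²}  this propagates the normalised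
-- identity  (-1)^N q^{N²} (1+q^{2N+1}) S_N = (1+q) D_N  from N = 0 up to N = n,
-- and dividing by the (nonzero) prefactor gives the theorem.

open import Defs
open import Data.Nat using (ℕ; _≤_) renaming (_*_ to _*ℕ_; _+_ to _+ℕ_)
open import Relation.Nullary using (¬_)
open import Algebra.Bundles using (CommutativeRing)
open import Data.Nat using (zero; suc; z≤n)
import Data.Nat as ℕ
import Data.Nat.Properties as ℕP
open import Data.Nat.Tactic.RingSolver using (solve-∀)
open import Data.Integer as ℤ using (ℤ; +_; -[1+_]; _⊖_; sign; ∣_∣)
import Data.Integer.Properties as ℤP
open import Data.Sign as Sign using (Sign)
open import Data.Maybe using (Maybe; just; nothing)
open import Function using (_∘_)
open import Relation.Nullary using (yes; no)
open import Relation.Binary.PropositionalEquality as ≡ using (_≡_)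
import Algebra.Solver.Ring.AlmostCommutativeRing as ACR

module IntegerCoefficients {c ℓ} (R : CommutativeRing c ℓ) where
  open CommutativeRing R
  open import Algebra.Properties.Ring ring
    using (-0#≈0#; -‿involutive; -‿anti-homo-+; -‿+-comm; xyx⁻¹≈y; -1*x≈-x)
  open import Algebra.Properties.Semiring.Mult.TCOptimised semiring using (_×_; 1+×; ×-homo-+; ×1-homo-*)
  open import Algebra.Properties.CommutativeSemigroup *-commutativeSemigroup using (interchange)
  open import Relation.Binary.Reasoning.Setoid setoid

  fromℕ : ℕ → Carrier
  fromℕ n = n × 1#

  fromℤ : ℤ → Carrier
  fromℤ (+ n)    = fromℕ n
  fromℤ -[1+ n ] = - fromℕ (suc n)

  fromℤ-⊖ : ∀ m n → fromℤ (m ⊖ n) ≈ fromℕ m - fromℕ n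
  fromℤ-⊖ m zero = begin
    fromℕ m      ≈⟨ +-identityʳ _ ⟨
    fromℕ m + 0# ≈⟨ +-congˡ -0#≈0# ⟨
    fromℕ m - 0# ∎
  fromℤ-⊖ zero (suc n) = sym (+-identityˡ _)
  fromℤ-⊖ (suc m) (suc n) = begin
    fromℤ (suc m ⊖ suc n)         ≡⟨ ≡.cong fromℤ (ℤP.[1+m]⊖[1+n]≡m⊖n m n) ⟩
    fromℤ (m ⊖ n)                 ≈⟨ fromℤ-⊖ m n ⟩
    a - b                         ≈⟨ xyx⁻¹≈y 1# (a - b) ⟨
    1# + (a - b) - 1#             ≈⟨ +-congʳ (+-assoc 1# a (- b)) ⟨
    (1# + a) - b - 1#             ≈⟨ +-assoc (1# + a) (- b) (- 1#) ⟩
    (1# + a) + (- b - 1#)         ≈⟨ +-congˡ (-‿anti-homo-+ 1# b) ⟨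
    (1# + a) - (1# + b)           ≈⟨ +-cong (1+× m 1#) (-‿cong (1+× n 1#)) ⟨
    fromℕ (suc m) - fromℕ (suc n) ∎
    where
    a b : Carrier
    a = fromℕ m
    b = fromℕ n

  fromℤ-+ : ∀ i j → fromℤ (i ℤ.+ j) ≈ fromℤ i + fromℤ j
  fromℤ-+ (+ m)    (+ n)    = ×-homo-+ 1# m n
  fromℤ-+ (+ m)    -[1+ n ] = fromℤ-⊖ m (suc n)
  fromℤ-+ -[1+ m ] (+ n)    = trans (fromℤ-⊖ n (suc m)) (+-comm _ _)
  fromℤ-+ -[1+ m ] -[1+ n ] = begin
    - fromℕ (suc (suc (m ℕ.+ n)))    ≡⟨ ≡.cong (λ k → - fromℕ (suc k)) (≡.sym (ℕP.+-suc m n)) ⟩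
    - fromℕ (suc m ℕ.+ suc n)        ≈⟨ -‿cong (×-homo-+ 1# (suc m) (suc n)) ⟩
    - (fromℕ (suc m) + fromℕ (suc n)) ≈⟨ -‿+-comm _ _ ⟨
    - fromℕ (suc m) - fromℕ (suc n)  ∎

  fromℤ-neg : ∀ i → fromℤ (ℤ.- i) ≈ - fromℤ i
  fromℤ-neg (+ zero)  = sym -0#≈0#
  fromℤ-neg (+ suc n) = refl
  fromℤ-neg -[1+ n ]  = sym (-‿involutive _)

  fromSign : Sign → Carrier
  fromSign Sign.+ = 1#
  fromSign Sign.- = - 1#

  fromSign-* : ∀ s t → fromSign (s Sign.* t) ≈ fromSign s * fromSign t
  fromSign-* Sign.+ t      = sym (*-identityˡ _)
  fromSign-* Sign.- Sign.+ = sym (*-identityʳ _)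
  fromSign-* Sign.- Sign.- = begin
    1#           ≈⟨ -‿involutive 1# ⟨
    - - 1#       ≈⟨ -1*x≈-x (- 1#) ⟨
    - 1# * - 1#  ∎

  fromℤ-◃ : ∀ s n → fromℤ (s ℤ.◃ n) ≈ fromSign s * fromℕ n
  fromℤ-◃ s      zero    = sym (zeroʳ _)
  fromℤ-◃ Sign.+ (suc n) = sym (*-identityˡ _)
  fromℤ-◃ Sign.- (suc n) = sym (-1*x≈-x _)

  fromℤ-signAbs : ∀ i → fromℤ i ≈ fromSign (sign i) * fromℕ ∣ i ∣
  fromℤ-signAbs i = trans (reflexive (≡.cong fromℤ (≡.sym (ℤP.◃-inverse i)))) (fromℤ-◃ (sign i) ∣ i ∣)

  fromℤ-* : ∀ i j → fromℤ (i ℤ.* j) ≈ fromℤ i * fromℤ j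
  fromℤ-* i j = begin
    fromℤ (sign i Sign.* sign j ℤ.◃ ∣ i ∣ ℕ.* ∣ j ∣)
      ≈⟨ fromℤ-◃ (sign i Sign.* sign j) (∣ i ∣ ℕ.* ∣ j ∣) ⟩
    fromSign (sign i Sign.* sign j) * fromℕ (∣ i ∣ ℕ.* ∣ j ∣)
      ≈⟨ *-cong (fromSign-* (sign i) (sign j)) (×1-homo-* ∣ i ∣ ∣ j ∣) ⟩
    (fromSign (sign i) * fromSign (sign j)) * (fromℕ ∣ i ∣ * fromℕ ∣ j ∣)
      ≈⟨ interchange _ _ _ _ ⟩
    (fromSign (sign i) * fromℕ ∣ i ∣) * (fromSign (sign j) * fromℕ ∣ j ∣)
      ≈⟨ *-cong (fromℤ-signAbs i) (fromℤ-signAbs j) ⟨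
    fromℤ i * fromℤ j ∎

  homomorphism : ℤ.+-*-rawRing ACR.-Raw-AlmostCommutative⟶ ACR.fromCommutativeRing R
  homomorphism = record
    { ⟦_⟧    = fromℤ
    ; +-homo = fromℤ-+
    ; *-homo = fromℤ-*
    ; -‿homo = fromℤ-neg
    ; 0-homo = refl
    ; 1-homo = refl
    }

  weaklyDecide : ∀ i j → Maybe (fromℤ i ≈ fromℤ j)
  weaklyDecide i j with i ℤ.≟ j
  ... | yes ≡.refl = just refl
  ... | no _       = nothing

  open import Algebra.Solver.Ring ℤ.+-*-rawRing (ACR.fromCommutativeRing R) homomorphism weaklyDecide public

  𝟙 : ∀ {k} → Polynomial k
  𝟙 = con (+ 1)

module IndexArithmetic where

  2[1+m] : ∀ m → 2 *ℕ suc m ≡ suc (suc (2 *ℕ m))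
  2[1+m] = solve-∀

  2m+2 : ∀ m → 2 *ℕ m +ℕ 2 ≡ 2 *ℕ suc m
  2m+2 = solve-∀

  2[1+m]+2 : ∀ m → 2 *ℕ suc m +ℕ 2 ≡ (2 *ℕ m +ℕ 2) +ℕ 2
  2[1+m]+2 = solve-∀

  [1+m]² : ∀ m → suc m *ℕ suc m ≡ m *ℕ m +ℕ (2 *ℕ m +ℕ 1)
  [1+m]² = solve-∀

  2m+2≡1+[2m+1] : ∀ m → 2 *ℕ m +ℕ 2 ≡ 1 +ℕ (2 *ℕ m +ℕ 1)
  2m+2≡1+[2m+1] = solve-∀

  2[1+m]+1 : ∀ m → 2 *ℕ suc m +ℕ 1 ≡ 2 +ℕ (2 *ℕ m +ℕ 1)
  2[1+m]+1 = solve-∀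

  [1+i]-[1+m] : ∀ i m → + suc i ℤ.- + suc m ≡ + i ℤ.- + m
  [1+i]-[1+m] i m = begin
    + suc i ℤ.- + suc m ≡⟨ ℤP.[+m]-[+n]≡m⊖n (suc i) (suc m) ⟩
    suc i ⊖ suc m       ≡⟨ ℤP.[1+m]⊖[1+n]≡m⊖n i m ⟩
    i ⊖ m               ≡⟨ ℤP.[+m]-[+n]≡m⊖n i m ⟨
    + i ℤ.- + m         ∎
    where open ≡.≡-Reasoning

  top-index : ∀ m → + suc (suc (2 *ℕ m)) ℤ.- + suc m ≡ + suc m
  top-index m = begin
    + suc (suc (2 *ℕ m)) ℤ.- + suc m ≡⟨ ≡.cong (λ k → + k ℤ.- + suc m) (double m) ⟩
    + (suc m +ℕ suc m) ℤ.- + suc m   ≡⟨ ℤP.[+m]-[+n]≡m⊖n (suc m +ℕ suc m) (suc m) ⟩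
    (suc m +ℕ suc m) ⊖ suc m         ≡⟨ ℤP.⊖-≥ (ℕP.m≤m+n (suc m) (suc m)) ⟩
    + (suc m +ℕ suc m ℕ.∸ suc m)     ≡⟨ ≡.cong +_ (ℕP.m+n∸m≡n (suc m) (suc m)) ⟩
    + suc m                          ∎
    where
    open ≡.≡-Reasoning
    double : ∀ m → suc (suc (2 *ℕ m)) ≡ suc m +ℕ suc m
    double = solve-∀

module FieldLemmas {c ℓ} (F : Field c ℓ) where
  open FieldDefs F hiding (zero)
  open IntegerCoefficients commutativeRing using (solve; _:=_; _:+_; _:*_; _:-_; :-_; con; 𝟙)
  open import Relation.Binary.Reasoning.Setoid setoid

  1≉0 : ¬ (1# ≈ 0#)
  1≉0 = 0≉1 ∘ sym

  *-cancelˡ : ∀ {k x y} → ¬ (k ≈ 0#) → k * x ≈ k * y → x ≈ y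
  *-cancelˡ {k} {x} {y} k≉0 eq = begin
    x                ≈⟨ *-identityˡ x ⟨
    1# * x           ≈⟨ *-congʳ (⁻¹-inverse k k≉0) ⟨
    (k * k ⁻¹) * x   ≈⟨ solve 3 (λ k k⁻¹ x → (k :* k⁻¹) :* x := k⁻¹ :* (k :* x)) refl k (k ⁻¹) x ⟩
    k ⁻¹ * (k * x)   ≈⟨ *-congˡ eq ⟩
    k ⁻¹ * (k * y)   ≈⟨ solve 3 (λ k k⁻¹ y → k⁻¹ :* (k :* y) := (k :* k⁻¹) :* y) refl k (k ⁻¹) y ⟩
    (k * k ⁻¹) * y   ≈⟨ *-congʳ (⁻¹-inverse k k≉0) ⟩
    1# * y           ≈⟨ *-identityˡ y ⟩
    y                ∎

  *-nonzero : ∀ {x y} → ¬ (x ≈ 0#) → ¬ (y ≈ 0#) → ¬ (x * y ≈ 0#)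
  *-nonzero {x} x≉0 y≉0 xy≈0 = y≉0 (*-cancelˡ x≉0 (trans xy≈0 (sym (zeroʳ x))))

  nonzero-factorˡ : ∀ {x y} → ¬ (x * y ≈ 0#) → ¬ (x ≈ 0#)
  nonzero-factorˡ {x} {y} xy≉0 x≈0 = xy≉0 (trans (*-congʳ x≈0) (zeroˡ y))

  nonzero-factorʳ : ∀ {x y} → ¬ (x * y ≈ 0#) → ¬ (y ≈ 0#)
  nonzero-factorʳ {x} {y} xy≉0 y≈0 = xy≉0 (trans (*-congˡ y≈0) (zeroʳ x))

  ⁻¹-unique : ∀ {y z} → ¬ (y ≈ 0#) → y * z ≈ 1# → z ≈ y ⁻¹
  ⁻¹-unique y≉0 yz≈1 = *-cancelˡ y≉0 (trans yz≈1 (sym (⁻¹-inverse _ y≉0)))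

  ⁻¹-split : ∀ {x y z} → ¬ ((x * y) * z ≈ 0#) → ((x * y) * z) ⁻¹ ≈ x ⁻¹ * (y * z) ⁻¹
  ⁻¹-split {x} {y} {z} xyz≉0 = sym (⁻¹-unique xyz≉0 (begin
    ((x * y) * z) * (x ⁻¹ * (y * z) ⁻¹)
      ≈⟨ solve 5 (λ x y z x⁻¹ yz⁻¹ → ((x :* y) :* z) :* (x⁻¹ :* yz⁻¹) := (x :* x⁻¹) :* ((y :* z) :* yz⁻¹))
               refl x y z (x ⁻¹) ((y * z) ⁻¹) ⟩
    (x * x ⁻¹) * ((y * z) * (y * z) ⁻¹) ≈⟨ *-cong (⁻¹-inverse x x≉0) (⁻¹-inverse (y * z) yz≉0) ⟩
    1# * 1#                             ≈⟨ *-identityʳ 1# ⟩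
    1#                                  ∎))
    where
    x[yz]≉0 : ¬ (x * (y * z) ≈ 0#)
    x[yz]≉0 e = xyz≉0 (trans (*-assoc x y z) e)
    x≉0 : ¬ (x ≈ 0#)
    x≉0 = nonzero-factorˡ x[yz]≉0
    yz≉0 : ¬ (y * z ≈ 0#)
    yz≉0 = nonzero-factorʳ x[yz]≉0

  ⁻¹-peel : ∀ {x u y v} → ¬ ((x * u) * (y * v) ≈ 0#) → ((x * u) * (y * v)) ⁻¹ * (u * v) ≈ (x * y) ⁻¹
  ⁻¹-peel {x} {u} {y} {v} ne = ⁻¹-unique xy≉0 (begin
    (x * y) * (((x * u) * (y * v)) ⁻¹ * (u * v))
      ≈⟨ solve 5 (λ x u y v w → (x :* y) :* (w :* (u :* v)) := ((x :* u) :* (y :* v)) :* w)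
               refl x u y v (((x * u) * (y * v)) ⁻¹) ⟩
    ((x * u) * (y * v)) * ((x * u) * (y * v)) ⁻¹ ≈⟨ ⁻¹-inverse _ ne ⟩
    1#                                            ∎)
    where
    xy≉0 : ¬ (x * y ≈ 0#)
    xy≉0 = *-nonzero (nonzero-factorˡ (nonzero-factorˡ ne)) (nonzero-factorˡ (nonzero-factorʳ ne))

  ^-≡ : ∀ x {m n} → m ≡ n → x ^ m ≈ x ^ n
  ^-≡ x eq = reflexive (≡.cong (x ^_) eq)

  ^-+ : ∀ x m n → x ^ (m +ℕ n) ≈ x ^ m * x ^ n
  ^-+ x zero    n = sym (*-identityˡ _)
  ^-+ x (suc m) n = trans (*-congˡ (^-+ x m n)) (sym (*-assoc _ _ _))

  ^-* : ∀ x m n → x ^ (m *ℕ n) ≈ (x ^ m) ^ n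
  ^-* x m zero    = ^-≡ x (ℕP.*-zeroʳ m)
  ^-* x m (suc n) = begin
    x ^ (m *ℕ suc n)     ≈⟨ ^-≡ x (ℕP.*-suc m n) ⟩
    x ^ (m +ℕ m *ℕ n)    ≈⟨ ^-+ x m (m *ℕ n) ⟩
    x ^ m * x ^ (m *ℕ n) ≈⟨ *-congˡ (^-* x m n) ⟩
    x ^ m * (x ^ m) ^ n  ∎

  ^-inverse : ∀ {x y} n → x * y ≈ 1# → x ^ n * y ^ n ≈ 1#
  ^-inverse zero    xy≈1 = *-identityʳ 1#
  ^-inverse {x} {y} (suc n) xy≈1 = begin
    (x * x ^ n) * (y * y ^ n) ≈⟨ solve 4 (λ x y xn yn → (x :* xn) :* (y :* yn) := (x :* y) :* (xn :* yn)) refl x y (x ^ n) (y ^ n) ⟩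
    (x * y) * (x ^ n * y ^ n) ≈⟨ *-cong xy≈1 (^-inverse n xy≈1) ⟩
    1# * 1#                   ≈⟨ *-identityʳ 1# ⟩
    1#                        ∎

  ^-nonzero : ∀ {x} n → ¬ (x ≈ 0#) → ¬ (x ^ n ≈ 0#)
  ^-nonzero zero    x≉0 = 1≉0
  ^-nonzero (suc n) x≉0 = *-nonzero x≉0 (^-nonzero n x≉0)

  sumTo-cong : ∀ K {f g} → (∀ k → k ≤ K → f k ≈ g k) → sumTo K f ≈ sumTo K g
  sumTo-cong zero    f≈g = f≈g zero z≤n
  sumTo-cong (suc K) f≈g = +-cong (sumTo-cong K (λ k k≤K → f≈g k (ℕP.m≤n⇒m≤1+n k≤K))) (f≈g (suc K) ℕP.≤-refl)

  sumTo-linear : ∀ K α β f g → α * sumTo K f + β * sumTo K g ≈ sumTo K (λ k → α * f k + β * g k)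
  sumTo-linear zero    α β f g = refl
  sumTo-linear (suc K) α β f g = trans
    (solve 6 (λ α β F f G g → α :* (F :+ f) :+ β :* (G :+ g) := (α :* F :+ β :* G) :+ (α :* f :+ β :* g))
           refl α β (sumTo K f) (f (suc K)) (sumTo K g) (g (suc K)))
    (+-congʳ (sumTo-linear K α β f g))

  sumTo-suc : ∀ K g → sumTo (suc K) g ≈ g zero + sumTo K (g ∘ suc)
  sumTo-suc zero    g = refl
  sumTo-suc (suc K) g = trans (+-congʳ (sumTo-suc K g)) (+-assoc _ _ _)

  telescope : ∀ K (G H : ℕ → Carrier) → (∀ k → suc k ≤ K → H k ≈ G (suc k)) →
    sumTo K (λ k → G k - H k) ≈ G zero - H K
  telescope zero    G H H≈G = refl
  telescope (suc K) G H H≈G = begin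
    sumTo K (λ k → G k - H k) + (G (suc K) - H (suc K))
      ≈⟨ +-congʳ (telescope K G H (λ k k<K → H≈G k (ℕP.m≤n⇒m≤1+n k<K))) ⟩
    (G zero - H K) + (G (suc K) - H (suc K)) ≈⟨ +-congʳ (+-congˡ (-‿cong (H≈G K ℕP.≤-refl))) ⟩
    (G zero - G (suc K)) + (G (suc K) - H (suc K))
      ≈⟨ solve 3 (λ a b c → (a :- b) :+ (b :- c) := a :- c) refl (G zero) (G (suc K)) (H (suc K)) ⟩
    G zero - H (suc K) ∎

  qPoch-congˡ : ∀ {x y} p k → x ≈ y → qPoch x p k ≈ qPoch y p k
  qPoch-congˡ p zero    x≈y = refl
  qPoch-congˡ p (suc k) x≈y = *-cong (qPoch-congˡ p k x≈y) (+-congˡ (-‿cong (*-congʳ x≈y)))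

  qPoch-unfoldˡ : ∀ x p k → qPoch x p (suc k) ≈ (1# - x) * qPoch (x * p) p k
  qPoch-unfoldˡ x p zero = solve 1 (λ x → 𝟙 :* (𝟙 :- x :* 𝟙) := (𝟙 :- x) :* 𝟙) refl x
  qPoch-unfoldˡ x p (suc k) = begin
    qPoch x p (suc k) * (1# - x * (p * p ^ k))              ≈⟨ *-congʳ (qPoch-unfoldˡ x p k) ⟩
    ((1# - x) * qPoch (x * p) p k) * (1# - x * (p * p ^ k))
      ≈⟨ solve 4 (λ x p pᵏ P → ((𝟙 :- x) :* P) :* (𝟙 :- x :* (p :* pᵏ))
                             := (𝟙 :- x) :* (P :* (𝟙 :- (x :* p) :* pᵏ)))
               refl x p (p ^ k) (qPoch (x * p) p k) ⟩
    (1# - x) * (qPoch (x * p) p k * (1# - (x * p) * p ^ k)) ∎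

  qPoch-vanish : ∀ {x p} m → x * p ^ m ≈ 1# → qPoch x p (suc m) ≈ 0#
  qPoch-vanish {x} {p} m xpᵐ≈1 = begin
    qPoch x p m * (1# - x * p ^ m) ≈⟨ *-congˡ (+-congˡ (-‿cong xpᵐ≈1)) ⟩
    qPoch x p m * (1# - 1#)        ≈⟨ solve 1 (λ P → P :* (𝟙 :- 𝟙) := con (+ 0)) refl (qPoch x p m) ⟩
    0#                             ∎

  sumSym-suc : ∀ m f → sumSym (suc m) f ≈ f -[1+ m ] + sumSym m f + f (+ suc m)
  sumSym-suc m f = begin
    sumTo (2 *ℕ suc m) g                                ≡⟨ ≡.cong (λ K → sumTo K g) (IndexArithmetic.2[1+m] m) ⟩
    sumTo (suc (2 *ℕ m)) g + g (suc (suc (2 *ℕ m)))     ≈⟨ +-congʳ (sumTo-suc (2 *ℕ m) g) ⟩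
    g zero + sumTo (2 *ℕ m) (g ∘ suc) + g (suc (suc (2 *ℕ m)))
      ≈⟨ +-cong (+-congˡ (sumTo-cong (2 *ℕ m) (λ i _ → reflexive (≡.cong f (IndexArithmetic.[1+i]-[1+m] i m)))))
                (reflexive (≡.cong f (IndexArithmetic.top-index m))) ⟩
    f -[1+ m ] + sumSym m f + f (+ suc m)               ∎
    where
    g : ℕ → Carrier
    g i = f (+ i ℤ.- + suc m)

  move-summand : ∀ {x y z} → x + y ≈ z → x ≈ z - y
  move-summand {x} {y} {z} x+y≈z = begin
    x           ≈⟨ solve 2 (λ x y → x := (x :+ y) :- y) refl x y ⟩
    (x + y) - y ≈⟨ +-congʳ x+y≈z ⟩
    z - y       ∎

  -- Verification of the telescoping certificate at one summation index: with
  -- b = p^k, U = (p^{-N};p)_k, U′ = (p^{1-N};p)_k, V = (a;p)_k, W = (ap;p)_k the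
  -- two hypotheses are the shift relations of these q-Pochhammer symbols.
  telescoping-certificate : ∀ {a q b U U′ V W} → ¬ (1# - a ≈ 0#) →
    (1# - a) * W ≈ V * (1# - a * b) → (a - 1#) * U′ ≈ U * (a - b) →
    a * (1# + a * q) * (U * W) + (q + a) * (U′ * V)
      ≈ a * ((1# + b) * (1# + q * b)) * (U * V) - q * (U * (a - b)) * (V * (1# - a * b))
  telescoping-certificate {a} {q} {b} {U} {U′} {V} {W} 1-a≉0 W-shift U-shift = *-cancelˡ 1-a≉0 (begin
    (1# - a) * (a * (1# + a * q) * (U * W) + (q + a) * (U′ * V))
      ≈⟨ solve 7 (λ a q b U U′ V W →
            (𝟙 :- a) :* (a :* (𝟙 :+ a :* q) :* (U :* W) :+ (q :+ a) :* (U′ :* V))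
         := a :* (𝟙 :+ a :* q) :* (U :* ((𝟙 :- a) :* W)) :- (q :+ a) :* (V :* ((a :- 𝟙) :* U′)))
         refl a q b U U′ V W ⟩
    a * (1# + a * q) * (U * ((1# - a) * W)) - (q + a) * (V * ((a - 1#) * U′))
      ≈⟨ +-cong (*-congˡ (*-congˡ W-shift)) (-‿cong (*-congˡ (*-congˡ U-shift))) ⟩
    a * (1# + a * q) * (U * (V * (1# - a * b))) - (q + a) * (V * (U * (a - b)))
      ≈⟨ solve 7 (λ a q b U U′ V W →
            a :* (𝟙 :+ a :* q) :* (U :* (V :* (𝟙 :- a :* b))) :- (q :+ a) :* (V :* (U :* (a :- b)))
         := (𝟙 :- a) :* (a :* ((𝟙 :+ b) :* (𝟙 :+ q :* b)) :* (U :* V) :- q :* (U :* (a :- b)) :* (V :* (𝟙 :- a :* b))))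
         refl a q b U U′ V W ⟩
    (1# - a) * (a * ((1# + b) * (1# + q * b)) * (U * V) - q * (U * (a - b)) * (V * (1# - a * b))) ∎)

  -- The induction step for the normalised identity  s Q (1+r) S = (1+q) D,  where at
  -- level m: s = (-1)^m, Q = q^{m²}, r = q^{2m+1}, so that at level m+1 the sign is
  -- -s, the power q^{(m+1)²} = Q r, and q^{2m+3} = q (q r).  The first hypothesis is
  -- the three-term recurrence linking the sums S (level m) and S′ (level m+1).
  normalised-step : ∀ {q r s Q S S′ D} → ¬ (q ≈ 0#) →
    (q * r) * (1# + (q * r) * q) * S′ + (q + q * r) * S ≈ (q * r) * ((1# + 1#) * (1# + q)) →
    s * Q * (1# + r) * S ≈ (1# + q) * D →
    (- 1# * s) * (Q * r) * (1# + q * (q * r)) * S′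
      ≈ (1# + q) * ((- 1# * s) * (Q * r) + D + (- 1# * s) * (Q * r))
  normalised-step {q} {r} {s} {Q} {S} {S′} {D} q≉0 recurrence hypothesis = *-cancelˡ q≉0 (begin
    q * ((- 1# * s) * (Q * r) * (1# + q * (q * r)) * S′)
      ≈⟨ solve 6 (λ q r s Q S S′ →
            q :* ((:- 𝟙 :* s) :* (Q :* r) :* (𝟙 :+ q :* (q :* r)) :* S′)
         := :- (s :* Q) :* ((q :* r) :* (𝟙 :+ (q :* r) :* q) :* S′))
         refl q r s Q S S′ ⟩
    - (s * Q) * ((q * r) * (1# + (q * r) * q) * S′)
      ≈⟨ *-congˡ (move-summand recurrence) ⟩
    - (s * Q) * ((q * r) * ((1# + 1#) * (1# + q)) - (q + q * r) * S)
      ≈⟨ solve 6 (λ q r s Q S S′ →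
            :- (s :* Q) :* ((q :* r) :* ((𝟙 :+ 𝟙) :* (𝟙 :+ q)) :- (q :+ q :* r) :* S)
         := :- (s :* Q) :* ((q :* r) :* ((𝟙 :+ 𝟙) :* (𝟙 :+ q))) :+ q :* (s :* Q :* (𝟙 :+ r) :* S))
         refl q r s Q S S′ ⟩
    - (s * Q) * ((q * r) * ((1# + 1#) * (1# + q))) + q * (s * Q * (1# + r) * S)
      ≈⟨ +-congˡ (*-congˡ hypothesis) ⟩
    - (s * Q) * ((q * r) * ((1# + 1#) * (1# + q))) + q * ((1# + q) * D)
      ≈⟨ solve 5 (λ q r s Q D →
            :- (s :* Q) :* ((q :* r) :* ((𝟙 :+ 𝟙) :* (𝟙 :+ q))) :+ q :* ((𝟙 :+ q) :* D)
         := q :* ((𝟙 :+ q) :* ((:- 𝟙 :* s) :* (Q :* r) :+ D :+ (:- 𝟙 :* s) :* (Q :* r))))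
         refl q r s Q D ⟩
    q * ((1# + q) * ((- 1# * s) * (Q * r) + D + (- 1# * s) * (Q * r))) ∎)

  divide-out : ∀ {s Q c x u d} → ¬ (Q * c ≈ 0#) → s * s ≈ 1# →
    s * Q * c * x ≈ u * d → x ≈ ((s * u) ÷ (Q * c)) * d
  divide-out {s} {Q} {c} {x} {u} {d} Qc≉0 s²≈1 sQcx≈ud = *-cancelˡ sK≉0 (begin
    (s * K) * x                             ≈⟨ solve 4 (λ s Q c x → (s :* (Q :* c)) :* x := s :* Q :* c :* x) refl s Q c x ⟩
    s * Q * c * x                           ≈⟨ sQcx≈ud ⟩
    u * d                                   ≈⟨ *-identityˡ (u * d) ⟨
    1# * (u * d)                            ≈⟨ *-congʳ (trans (*-cong s²≈1 (⁻¹-inverse K Qc≉0)) (*-identityˡ 1#)) ⟨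
    ((s * s) * (K * K ⁻¹)) * (u * d)
      ≈⟨ solve 5 (λ s K K⁻¹ u d → ((s :* s) :* (K :* K⁻¹)) :* (u :* d) := (s :* K) :* (((s :* u) :* K⁻¹) :* d))
               refl s K (K ⁻¹) u d ⟩
    (s * K) * (((s * u) ÷ K) * d)           ∎)
    where
    K : Carrier
    K = Q * c
    s≉0 : ¬ (s ≈ 0#)
    s≉0 s≈0 = 1≉0 (trans (sym s²≈1) (trans (*-congʳ s≈0) (zeroˡ s)))
    sK≉0 : ¬ (s * K ≈ 0#)
    sK≉0 = *-nonzero s≉0 Qc≉0

module ThreePhiTwo {c ℓ} (F : Field c ℓ) where
  open FieldDefs F hiding (zero)
  open FieldLemmas F
  open IntegerCoefficients commutativeRing using (solve; _:=_; _:+_; _:*_; _:-_; :-_; con; 𝟙)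
  open import Algebra.Properties.Ring ring using (-0#≈0#)
  open import Relation.Binary.Reasoning.Setoid setoid

  module Series (q : Carrier) (q≉0 : ¬ (q ≈ 0#)) (n : ℕ)
    (denominators≉0 : ∀ k → k ≤ n →
      ¬ (qPoch (q ^ 2) (q ^ 2) k * qPoch (- (q ^ 2)) (q ^ 2) k * qPoch (- (q ^ 3)) (q ^ 2) k ≈ 0#)) where

    p ι : Carrier
    p = q ^ 2
    ι = p ⁻¹

    pι≈1 : p * ι ≈ 1#
    pι≈1 = ⁻¹-inverse p (^-nonzero 2 q≉0)

    t : ℕ → ℕ → Carrier
    t N = phi32Term (ι ^ N) (q ^ (2 *ℕ N +ℕ 2)) p (- p) (- (q ^ 3)) p q

    S : ℕ → Carrier
    S N = phi32Terminating N (q ^ (2 *ℕ N +ℕ 2)) p (- p) (- (q ^ 3)) p q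

    -- the part of the denominator of t N k that is independent of N:  1 / ((-p;p)_k (-q³;p)_k)
    E : ℕ → Carrier
    E k = (qPoch (- p) p k * qPoch (- (q ^ 3)) p k) ⁻¹

    qPoch-p≉0 : ∀ k → k ≤ n → ¬ (qPoch p p k ≈ 0#)
    qPoch-p≉0 k k≤n = nonzero-factorˡ (nonzero-factorˡ (denominators≉0 k k≤n))

    E-denominator≉0 : ∀ k → k ≤ n → ¬ (qPoch (- p) p k * qPoch (- (q ^ 3)) p k ≈ 0#)
    E-denominator≉0 k k≤n B≈0 = denominators≉0 k k≤n (trans (*-assoc _ _ _) (trans (*-congˡ B≈0) (zeroʳ _)))

    E-zero : E 0 ≈ 1#
    E-zero = sym (⁻¹-unique (*-nonzero 1≉0 1≉0) (trans (*-identityʳ _) (*-identityʳ 1#)))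

    E-suc : ∀ k → suc k ≤ n → E (suc k) * ((1# - (- p) * p ^ k) * (1# - (- (q ^ 3)) * p ^ k)) ≈ E k
    E-suc k k<n = ⁻¹-peel (E-denominator≉0 (suc k) k<n)

    -- the factor (p;p)_k of the denominator cancels against the numerator parameter p
    term-formula : ∀ N k → k ≤ n →
      t N k ≈ (qPoch (ι ^ N) p k * qPoch (q ^ (2 *ℕ N +ℕ 2)) p k) * (q ^ k * E k)
    term-formula N k k≤n = begin
      (((X * Y) * P) * q ^ k) * ((P * B₁) * B₂) ⁻¹ ≈⟨ *-congˡ (⁻¹-split (denominators≉0 k k≤n)) ⟩
      (((X * Y) * P) * q ^ k) * (P ⁻¹ * E k)
        ≈⟨ solve 6 (λ X Y P qᵏ P⁻¹ Eₖ → (((X :* Y) :* P) :* qᵏ) :* (P⁻¹ :* Eₖ) := ((X :* Y) :* (qᵏ :* Eₖ)) :* (P :* P⁻¹))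
                 refl X Y P (q ^ k) (P ⁻¹) (E k) ⟩
      ((X * Y) * (q ^ k * E k)) * (P * P ⁻¹)  ≈⟨ *-congˡ (⁻¹-inverse P (qPoch-p≉0 k k≤n)) ⟩
      ((X * Y) * (q ^ k * E k)) * 1#          ≈⟨ *-identityʳ _ ⟩
      (X * Y) * (q ^ k * E k)                 ∎
      where
      X Y P B₁ B₂ : Carrier
      X = qPoch (ι ^ N) p k
      Y = qPoch (q ^ (2 *ℕ N +ℕ 2)) p k
      P = qPoch p p k
      B₁ = qPoch (- p) p k
      B₂ = qPoch (- (q ^ 3)) p k

    module Recurrence (m : ℕ) (N≤n : suc m ≤ n) where
      N : ℕ
      N = suc m

      a : Carrier
      a = q ^ (2 *ℕ m +ℕ 2)

      a≈pᴺ : a ≈ p ^ N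
      a≈pᴺ = trans (^-≡ q (IndexArithmetic.2m+2 m)) (^-* q 2 N)

      aιᴺ≈1 : a * ι ^ N ≈ 1#
      aιᴺ≈1 = trans (*-congʳ a≈pᴺ) (^-inverse N pι≈1)

      -- the last factor 1 - p^N of (p;p)_N is nonzero
      1-a≉0 : ¬ (1# - a ≈ 0#)
      1-a≉0 1-a≈0 = nonzero-factorʳ (qPoch-p≉0 N N≤n) (trans (+-congˡ (-‿cong (sym a≈pᴺ))) 1-a≈0)

      a-scale : ∀ x → a * (1# - ι ^ N * x) ≈ a - x
      a-scale x = begin
        a * (1# - ι ^ N * x)   ≈⟨ solve 3 (λ a ιᴺ x → a :* (𝟙 :- ιᴺ :* x) := a :- (a :* ιᴺ) :* x) refl a (ι ^ N) x ⟩
        a - (a * ι ^ N) * x    ≈⟨ +-congˡ (-‿cong (trans (*-congʳ aιᴺ≈1) (*-identityˡ x))) ⟩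
        a - x                  ∎

      U U′ V W w : ℕ → Carrier
      U  k = qPoch (ι ^ N) p k
      U′ k = qPoch (ι ^ m) p k
      V  k = qPoch a p k
      W  k = qPoch (q ^ (2 *ℕ N +ℕ 2)) p k
      w  k = q ^ k * E k

      W-shift : ∀ k → (1# - a) * W k ≈ V k * (1# - a * p ^ k)
      W-shift k = sym (trans (qPoch-unfoldˡ a p k) (*-congˡ (qPoch-congˡ p k ap≈)))
        where
        ap≈ : a * p ≈ q ^ (2 *ℕ N +ℕ 2)
        ap≈ = trans (sym (^-+ q (2 *ℕ m +ℕ 2) 2)) (^-≡ q (≡.sym (IndexArithmetic.2[1+m]+2 m)))

      U-shift : ∀ k → (a - 1#) * U′ k ≈ U k * (a - p ^ k)
      U-shift k = begin
        (a - 1#) * U′ k                       ≈⟨ *-congʳ (a-scale 1#) ⟨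
        (a * (1# - ι ^ N * 1#)) * U′ k
          ≈⟨ solve 3 (λ a ιᴺ u → (a :* (𝟙 :- ιᴺ :* 𝟙)) :* u := a :* ((𝟙 :- ιᴺ) :* u)) refl a (ι ^ N) (U′ k) ⟩
        a * ((1# - ι ^ N) * U′ k)             ≈⟨ *-congˡ (sym (trans (qPoch-unfoldˡ (ι ^ N) p k) (*-congˡ (qPoch-congˡ p k ιᴺp≈ιᵐ)))) ⟩
        a * (U k * (1# - ι ^ N * p ^ k))      ≈⟨ solve 3 (λ a u x → a :* (u :* x) := u :* (a :* x)) refl a (U k) (1# - ι ^ N * p ^ k) ⟩
        U k * (a * (1# - ι ^ N * p ^ k))      ≈⟨ *-congˡ (a-scale (p ^ k)) ⟩
        U k * (a - p ^ k)                     ∎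
        where
        ιᴺp≈ιᵐ : ι ^ N * p ≈ ι ^ m
        ιᴺp≈ιᵐ = begin
          (ι * ι ^ m) * p   ≈⟨ solve 3 (λ ι ιᵐ p → (ι :* ιᵐ) :* p := (p :* ι) :* ιᵐ) refl ι (ι ^ m) p ⟩
          (p * ι) * ι ^ m   ≈⟨ *-congʳ pι≈1 ⟩
          1# * ι ^ m        ≈⟨ *-identityˡ _ ⟩
          ι ^ m             ∎

      -- the WZ certificate G and its shifted form H k = G (k+1)
      G H : ℕ → Carrier
      G k = a * ((1# + p ^ k) * (1# + q * p ^ k)) * (U k * V k) * w k
      H k = q * (U k * (a - p ^ k)) * (V k * (1# - a * p ^ k)) * w k

      α β : Carrier
      α = a * (1# + a * q)
      β = q + a

      termwise : ∀ k → k ≤ N → α * t N k + β * t m k ≈ G k - H k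
      termwise k k≤N = begin
        α * t N k + β * t m k
          ≈⟨ +-cong (*-congˡ (term-formula N k k≤n)) (*-congˡ (term-formula m k k≤n)) ⟩
        α * ((U k * W k) * w k) + β * ((U′ k * V k) * w k)
          ≈⟨ solve 5 (λ α β x y w → α :* (x :* w) :+ β :* (y :* w) := (α :* x :+ β :* y) :* w)
                   refl α β (U k * W k) (U′ k * V k) (w k) ⟩
        (α * (U k * W k) + β * (U′ k * V k)) * w k
          ≈⟨ *-congʳ (telescoping-certificate 1-a≉0 (W-shift k) (U-shift k)) ⟩
        (a * ((1# + p ^ k) * (1# + q * p ^ k)) * (U k * V k) - q * (U k * (a - p ^ k)) * (V k * (1# - a * p ^ k))) * w k
          ≈⟨ solve 3 (λ x y w → (x :- y) :* w := x :* w :- y :* w)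
                   refl (a * ((1# + p ^ k) * (1# + q * p ^ k)) * (U k * V k)) (q * (U k * (a - p ^ k)) * (V k * (1# - a * p ^ k))) (w k) ⟩
        G k - H k ∎
        where
        k≤n : k ≤ n
        k≤n = ℕP.≤-trans k≤N N≤n

      H≈G-suc : ∀ k → suc k ≤ N → H k ≈ G (suc k)
      H≈G-suc k k<N = sym (begin
        G (suc k)
          ≈⟨ solve 9 (λ a q pᵏ u v x y qᵏ e →
                a :* ((𝟙 :+ (q :* (q :* 𝟙)) :* pᵏ) :* (𝟙 :+ q :* ((q :* (q :* 𝟙)) :* pᵏ))) :* ((u :* x) :* (v :* y)) :* ((q :* qᵏ) :* e)
             := q :* (u :* (a :* x)) :* (v :* y)
                  :* (qᵏ :* (e :* ((𝟙 :- (:- (q :* (q :* 𝟙))) :* pᵏ) :* (𝟙 :- (:- (q :* (q :* (q :* 𝟙)))) :* pᵏ)))))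
                   refl a q (p ^ k) (U k) (V k) (1# - ι ^ N * p ^ k) (1# - a * p ^ k) (q ^ k) (E (suc k)) ⟩
        q * (U k * (a * (1# - ι ^ N * p ^ k))) * (V k * (1# - a * p ^ k))
          * (q ^ k * (E (suc k) * ((1# - (- p) * p ^ k) * (1# - (- (q ^ 3)) * p ^ k))))
          ≈⟨ *-cong (*-congʳ (*-congˡ (*-congˡ (a-scale (p ^ k))))) (*-congˡ (E-suc k (ℕP.≤-trans k<N N≤n))) ⟩
        H k ∎)

      G-zero : G 0 ≈ a * ((1# + 1#) * (1# + q))
      G-zero = begin
        a * ((1# + 1#) * (1# + q * 1#)) * (1# * 1#) * (1# * E 0)   ≈⟨ *-congˡ (*-congˡ E-zero) ⟩
        a * ((1# + 1#) * (1# + q * 1#)) * (1# * 1#) * (1# * 1#)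
          ≈⟨ solve 2 (λ a q → a :* ((𝟙 :+ 𝟙) :* (𝟙 :+ q :* 𝟙)) :* (𝟙 :* 𝟙) :* (𝟙 :* 𝟙) := a :* ((𝟙 :+ 𝟙) :* (𝟙 :+ q))) refl a q ⟩
        a * ((1# + 1#) * (1# + q))                                  ∎

      H-top : H N ≈ 0#
      H-top = begin
        q * (U N * (a - p ^ N)) * (V N * (1# - a * p ^ N)) * w N ≈⟨ *-congʳ (*-congʳ (*-congˡ (*-congˡ (+-congˡ (-‿cong (sym a≈pᴺ)))))) ⟩
        q * (U N * (a - a)) * (V N * (1# - a * p ^ N)) * w N
          ≈⟨ solve 5 (λ q u a y w → q :* (u :* (a :- a)) :* y :* w := con (+ 0)) refl q (U N) a (V N * (1# - a * p ^ N)) (w N) ⟩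
        0#                                                       ∎

      t-m-top : t m N ≈ 0#
      t-m-top = begin
        t m N                      ≈⟨ term-formula m N N≤n ⟩
        (U′ N * V N) * w N         ≈⟨ *-congʳ (*-congʳ (qPoch-vanish m (^-inverse m (trans (*-comm ι p) pι≈1)))) ⟩
        (0# * V N) * w N           ≈⟨ trans (*-congʳ (zeroˡ (V N))) (zeroˡ (w N)) ⟩
        0#                         ∎

      recurrence : α * S N + β * S m ≈ a * ((1# + 1#) * (1# + q))
      recurrence = begin
        α * S N + β * S m                          ≈⟨ +-congˡ (*-congˡ (trans (+-congˡ t-m-top) (+-identityʳ _))) ⟨
        α * S N + β * sumTo N (t m)                ≈⟨ sumTo-linear N α β (t N) (t m) ⟩
        sumTo N (λ k → α * t N k + β * t m k)      ≈⟨ sumTo-cong N termwise ⟩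
        sumTo N (λ k → G k - H k)                  ≈⟨ telescope N G H H≈G-suc ⟩
        G 0 - H N                                  ≈⟨ +-cong G-zero (-‿cong H-top) ⟩
        a * ((1# + 1#) * (1# + q)) - 0#            ≈⟨ trans (+-congˡ -0#≈0#) (+-identityʳ _) ⟩
        a * ((1# + 1#) * (1# + q))                 ∎

    D : ℕ → Carrier
    D N = sumSym N (λ j → signZ j * powSq q j)

    -- the theorem at N, with the prefactor multiplied out
    NormalisedIdentity : ℕ → Set ℓ
    NormalisedIdentity N = (- 1#) ^ N * q ^ (N *ℕ N) * (1# + q ^ (2 *ℕ N +ℕ 1)) * S N ≈ (1# + q) * D N

    normalised-zero : NormalisedIdentity 0
    normalised-zero = begin
      1# * 1# * (1# + q * 1#) * S 0   ≈⟨ *-congˡ (term-formula 0 0 z≤n) ⟩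
      1# * 1# * (1# + q * 1#) * ((1# * 1#) * (1# * E 0)) ≈⟨ *-congˡ (*-congˡ (*-congˡ E-zero)) ⟩
      1# * 1# * (1# + q * 1#) * ((1# * 1#) * (1# * 1#))
        ≈⟨ solve 1 (λ q → 𝟙 :* 𝟙 :* (𝟙 :+ q :* 𝟙) :* ((𝟙 :* 𝟙) :* (𝟙 :* 𝟙)) := (𝟙 :+ q) :* (𝟙 :* 𝟙)) refl q ⟩
      (1# + q) * D 0                  ∎

    normalised-suc : ∀ m → suc m ≤ n → NormalisedIdentity m → NormalisedIdentity (suc m)
    normalised-suc m N≤n hypothesis = begin
      (- 1# * s) * q ^ (N *ℕ N) * (1# + q ^ (2 *ℕ N +ℕ 1)) * S N
        ≈⟨ *-congʳ (*-cong (*-congˡ q^N²≈) (+-congˡ (^-≡ q (IndexArithmetic.2[1+m]+1 m)))) ⟩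
      (- 1# * s) * (Q * r) * (1# + q * (q * r)) * S N
        ≈⟨ normalised-step q≉0 recurrence′ hypothesis ⟩
      (1# + q) * ((- 1# * s) * (Q * r) + D m + (- 1# * s) * (Q * r))
        ≈⟨ *-congˡ (+-cong (+-congʳ σ) σ) ⟨
      (1# + q) * (f -[1+ m ] + D m + f (+ N)) ≈⟨ *-congˡ (sumSym-suc m f) ⟨
      (1# + q) * D N                   ∎
      where
      open Recurrence m N≤n using (N; a; recurrence)
      f : ℤ → Carrier
      f j = signZ j * powSq q j
      s Q r : Carrier
      s = (- 1#) ^ m
      Q = q ^ (m *ℕ m)
      r = q ^ (2 *ℕ m +ℕ 1)
      q^N²≈ : q ^ (N *ℕ N) ≈ Q * r
      q^N²≈ = trans (^-≡ q (IndexArithmetic.[1+m]² m)) (^-+ q (m *ℕ m) (2 *ℕ m +ℕ 1))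
      σ : f (+ N) ≈ (- 1# * s) * (Q * r)
      σ = *-congˡ q^N²≈
      a≈qr : a ≈ q * r
      a≈qr = ^-≡ q (IndexArithmetic.2m+2≡1+[2m+1] m)
      recurrence′ : (q * r) * (1# + (q * r) * q) * S N + (q + q * r) * S m ≈ (q * r) * ((1# + 1#) * (1# + q))
      recurrence′ = begin
        (q * r) * (1# + (q * r) * q) * S N + (q + q * r) * S m
          ≈⟨ +-cong (*-congʳ (*-cong a≈qr (+-congˡ (*-congʳ a≈qr)))) (*-congʳ (+-congˡ a≈qr)) ⟨
        a * (1# + a * q) * S N + (q + a) * S m ≈⟨ recurrence ⟩
        a * ((1# + 1#) * (1# + q))             ≈⟨ *-congʳ a≈qr ⟩
        (q * r) * ((1# + 1#) * (1# + q))       ∎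

    normalised-identity : ∀ N → N ≤ n → NormalisedIdentity N
    normalised-identity zero    _   = normalised-zero
    normalised-identity (suc m) N≤n = normalised-suc m N≤n (normalised-identity m (ℕP.<⇒≤ N≤n))

lemma3p2 : ∀ {c ℓ} (F : Field c ℓ) → let open FieldDefs F in
    (q : Carrier) → ¬ (q ≈ 0#) →
    (n : ℕ) →
    (∀ k → k ≤ n →
      ¬ (qPoch (q ^ 2) (q ^ 2) k * qPoch (- (q ^ 2)) (q ^ 2) k * qPoch (- (q ^ 3)) (q ^ 2) k ≈ 0#)) →
    ¬ (1# + q ^ (2 *ℕ n +ℕ 1) ≈ 0#) →
    phi32Terminating n (q ^ (2 *ℕ n +ℕ 2)) (q ^ 2) (- (q ^ 2)) (- (q ^ 3)) (q ^ 2) q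
      ≈ (((- 1#) ^ n * (1# + q)) ÷ (q ^ (n *ℕ n) * (1# + q ^ (2 *ℕ n +ℕ 1))))
          * sumSym n (λ j → signZ j * powSq q j)
lemma3p2 F q q≉0 n denominators≉0 1+q²ⁿ⁺¹≉0 =
  divide-out prefactor≉0 (^-inverse n -1*-1≈1) (normalised-identity n ℕP.≤-refl)
  where
  open FieldDefs F hiding (zero)
  open FieldLemmas F
  open ThreePhiTwo.Series F q q≉0 n denominators≉0
  open IntegerCoefficients commutativeRing using (solve; _:=_; _:*_; :-_; 𝟙)
  prefactor≉0 : ¬ (q ^ (n *ℕ n) * (1# + q ^ (2 *ℕ n +ℕ 1)) ≈ 0#)
  prefactor≉0 = *-nonzero (^-nonzero (n *ℕ n) q≉0) 1+q²ⁿ⁺¹≉0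
  -1*-1≈1 : - 1# * - 1# ≈ 1#
  -1*-1≈1 = solve 0 (:- 𝟙 :* :- 𝟙 := 𝟙) refl
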